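{- For every $n\ge1$, the alternating permutations in $S_{2n}$ are in bijection with the noncrossing arc diagrams on $2n$ points that are perfect matchings.
   Context: An alternating permutation in $S_{2n}$ is a permutation $x$ of $\{1,\ldots,2n\}$ with $x_1>x_2<x_3>x_4<\cdots<x_{2n-1}>x_{2n}$. Place points $1,\ldots,m$ bottom to top on a vertical line. An arc joins a point $p$ to a strictly higher point $q$, moving monotonically upward and passing left or right of each intermediate point; arcs are considered up to combinatorial equivalence (endpoints and set of intermediate points on the left). A noncrossing arc diagram is a collection of arcs such that no two intersect except possibly at endpoints and no two share the same upper endpoint or the same lower endpoint, considered up to combinatorial equivalence. It is a perfect matching if its arcs are pairwise disjoint (even at endpoints) and every point is an endpoint of some arc. -}

module Defs where

open import Level using (0ℓ)
open import Data.Nat as ℕ using (ℕ; zero; suc; _+_; _*_)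
open import Data.Fin using (Fin; toℕ; fromℕ<)
open import Data.Fin.Subset using (Subset; _∈_; _∉_)
open import Data.Vec using (Vec; lookup)
open import Data.List using (List)
import Data.List.Membership.Propositional as LMem
open import Data.List.Relation.Unary.Unique.Propositional using (Unique)
open import Data.List.Relation.Binary.Permutation.Propositional
  using (_↭_; ↭-isEquivalence)
open import Data.Product using (_×_; ∃; ∃₂; _,_; proj₁; proj₂)
open import Data.Sum using (_⊎_)
open import Data.Refinement using (Refinement; value)
open import Relation.Binary.PropositionalEquality using (_≡_; _≢_)
open import Relation.Binary.Bundles using (Setoid)
open import Relation.Binary.Structures using (IsEquivalence)
open import Relation.Nullary using (¬_)
open import Function.Definitions using (Injective)

-- Convention: the points 1,…,m of the paper are represented by Fin m,
-- i.e. by 0,…,m-1 (point i+1 of the paper is  i : Fin m); "higher"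
-- means larger.  Likewise permutations of {1,…,m} are permutations of
-- Fin m, written in one-line notation.

IsPermutation : {m : ℕ} → Vec (Fin m) m → Set
IsPermutation {m} x = Injective _≡_ _≡_ (lookup x)

-- x₁ > x₂ < x₃ > x₄ < ⋯ : (0-indexed) x(2j) > x(2j+1) and x(2j+1) < x(2j+2),
-- whenever these positions exist.
IsAlternating : {m : ℕ} → Vec (Fin m) m → Set
IsAlternating {m} x =
  (∀ (j : ℕ) (p : 2 * j ℕ.< m) (q : suc (2 * j) ℕ.< m) →
      toℕ (lookup x (fromℕ< q)) ℕ.< toℕ (lookup x (fromℕ< p)))
  ×
  (∀ (j : ℕ) (p : suc (2 * j) ℕ.< m) (q : suc (suc (2 * j)) ℕ.< m) →
      toℕ (lookup x (fromℕ< p)) ℕ.< toℕ (lookup x (fromℕ< q)))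

AltPerm : ℕ → Set
AltPerm m = Refinement (Vec (Fin m) m) (λ x → IsPermutation x × IsAlternating x)

-- Arcs, up to combinatorial equivalence: lower endpoint, upper endpoint,
-- and the set of intermediate points passed on the left.

_<ᶠ_ : {m : ℕ} → Fin m → Fin m → Set
i <ᶠ j = toℕ i ℕ.< toℕ j

RawArc : ℕ → Set
RawArc m = Fin m × Fin m × Subset m

WfArc : {m : ℕ} → RawArc m → Set
WfArc (p , q , L) = (p <ᶠ q) × (∀ k → k ∈ L → (p <ᶠ k) × (k <ᶠ q))

Arc : ℕ → Set
Arc m = Refinement (RawArc m) WfArc

lo : {m : ℕ} → Arc m → Fin m
lo a = proj₁ (value a)

hi : {m : ℕ} → Arc m → Fin m
hi a = proj₁ (proj₂ (value a))

leftSet : {m : ℕ} → Arc m → Subset m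
leftSet a = proj₂ (proj₂ (value a))

PassesLeft : {m : ℕ} → Arc m → Fin m → Set
PassesLeft a k = k ∈ leftSet a

PassesRight : {m : ℕ} → Arc m → Fin m → Set
PassesRight a k = (lo a <ᶠ k) × (k <ᶠ hi a) × (k ∉ leftSet a)

IsEndpoint : {m : ℕ} → Arc m → Fin m → Set
IsEndpoint a k = (k ≡ lo a) ⊎ (k ≡ hi a)

StrictlyLeftAt : {m : ℕ} → Arc m → Arc m → Fin m → Set
StrictlyLeftAt a b k =
  (PassesLeft a k × (IsEndpoint b k ⊎ PassesRight b k))
  ⊎ (IsEndpoint a k × PassesRight b k)

-- Two arcs cross (must intersect at a point other than a common endpoint,
-- in every representative) iff their left-right order is forced to change.
Cross : {m : ℕ} → Arc m → Arc m → Set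
Cross a b = ∃₂ λ k₁ k₂ → StrictlyLeftAt a b k₁ × StrictlyLeftAt b a k₂

-- Arc diagrams: finite sets of arcs, represented by duplicate-free lists,
-- considered up to reordering.

module _ {m : ℕ} where
  open LMem {A = Arc m} using () renaming (_∈_ to _∈ₗ_)

  IsNoncrossingArcDiagram : List (Arc m) → Set
  IsNoncrossingArcDiagram D =
    Unique D ×
    (∀ a b → a ∈ₗ D → b ∈ₗ D → a ≢ b →
        ¬ Cross a b × lo a ≢ lo b × hi a ≢ hi b)

  IsPerfectMatching : List (Arc m) → Set
  IsPerfectMatching D =
    (∀ a b → a ∈ₗ D → b ∈ₗ D → a ≢ b →
        ¬ (∃ λ k → IsEndpoint a k × IsEndpoint b k))
    × (∀ (k : Fin m) → ∃ λ a → a ∈ₗ D × IsEndpoint a k)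

NoncrossingPerfectMatching : ℕ → Set
NoncrossingPerfectMatching m =
  Refinement (List (Arc m)) (λ D → IsNoncrossingArcDiagram D × IsPerfectMatching D)

NoncrossingPerfectMatchingSetoid : ℕ → Setoid 0ℓ 0ℓ
NoncrossingPerfectMatchingSetoid m = record
  { Carrier = NoncrossingPerfectMatching m
  ; _≈_ = λ D E → value D ↭ value E
  ; isEquivalence = record
      { refl = IsEq.refl ; sym = IsEq.sym ; trans = IsEq.trans } }
  where
  module IsEq = IsEquivalence (↭-isEquivalence {A = Arc m})

module Submission where

-- Read an alternating permutation x₁ > x₂ < x₃ > ⋯ as the pairs x₂ᵢ₋₁ > x₂ᵢ, each giving the
-- arc from x₂ᵢ up to x₂ᵢ₋₁ that passes left of exactly those points between its endpoints
-- that occur earlier in the word. A later arc then passes left of every earlier endpoint it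
-- meets, so no earlier arc is ever left of a later one; this makes the diagram noncrossing,
-- and x being a permutation makes it a perfect matching. Conversely, the arcs of a
-- noncrossing perfect matching can be listed so that no arc is left of a later one and the
-- lower endpoint of each arc lies below the upper endpoint of the next: repeatedly take, among
-- the arcs not left of any other, one with the lowest lower endpoint. Such a listing is unique
-- and its word of endpoints is alternating, which gives the inverse map.

open import Defs
open import Data.Nat using (ℕ; _≤_; _*_)
open import Relation.Binary.PropositionalEquality using (setoid)
open import Function.Bundles using (Bijection)

open import Level using (0ℓ)
open import Data.Nat using (zero; suc; _<_; z≤n; s≤s)
import Data.Nat.Properties as ℕ
open import Data.Fin using (Fin; toℕ; fromℕ<)
import Data.Fin.Properties as Fin
open import Data.Fin.Subset using (Subset; _∈_)
open import Data.Fin.Subset.Properties using (_∈?_; ⊆-antisym)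
open import Data.Vec using (Vec; []; _∷_; lookup; tabulate; toList; fromList; cast)
import Data.Vec.Properties as Vec
open import Data.Vec.Relation.Binary.Equality.Cast using (cast-is-id)
import Data.Vec.Relation.Unary.All.Properties as VecAll
open import Data.Vec.Relation.Unary.AllPairs using ([]; _∷_)
open import Data.Vec.Relation.Unary.Unique.Propositional using () renaming (Unique to VecUnique)
import Data.Vec.Relation.Unary.Unique.Propositional.Properties as VecUnique
open import Data.List using (List; []; _∷_; _++_; length; filter; drop)
import Data.List as List
open import Data.List.Membership.Propositional using () renaming (_∈_ to _∈ₗ_)
open import Data.List.Membership.Propositional.Properties using (∈-∃++; ∈-filter⁺; ∈-filter⁻)
open import Data.List.Relation.Unary.Any using (here; there; any?; index)
open import Data.List.Relation.Unary.Any.Properties using (lookup-index)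
open import Data.List.Relation.Unary.All as All using (All; []; _∷_)
open import Data.List.Relation.Unary.All.Properties using (¬Any⇒All¬)
open import Data.List.Relation.Unary.AllPairs as AllPairs using (AllPairs; []; _∷_)
open import Data.List.Relation.Unary.Linked as Linked using (Linked; []; [-]; _∷_)
open import Data.List.Relation.Unary.Unique.Propositional using (Unique)
open import Data.List.Relation.Binary.Disjoint.Propositional using (Disjoint)
open import Data.List.Relation.Binary.Permutation.Propositional
  using (_↭_; ↭-refl; ↭-sym; ↭-trans; ↭-prep; ↭⇒↭ₛ)
open import Data.List.Relation.Binary.Permutation.Propositional.Properties
  using (∈-resp-↭; All-resp-↭; shift; ↭-length; drop-∷; ¬x∷xs↭[])
open import Data.List.Relation.Binary.Permutation.Setoid.Properties using (Unique-resp-↭)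
open import Data.List.Extrema ℕ.≤-totalOrder
  using (argmax; argmin; argmax-sel; argmin-sel; f[xs]≤f[argmax]; f[argmin]≤f[xs])
open import Data.Product using (_×_; ∃; _,_; proj₁; proj₂)
import Data.Product as Product
open import Data.Sum using (_⊎_; inj₁; inj₂; [_,_]′)
open import Data.Unit using (⊤; tt)
open import Data.Empty using (⊥; ⊥-elim; ⊥-elim-irr)
open import Data.Irrelevant using ([_])
import Data.Refinement as Ref
open import Data.Refinement using (value)
open import Function using (_∘_; id; _⇔_; mk⇔; Equivalence)
open import Function.Definitions using (Injective)
open import Relation.Binary.PropositionalEquality
  using (_≡_; _≢_; refl; sym; trans; cong; cong₂; subst; subst₂; module ≡-Reasoning)
open import Relation.Binary.Definitions using (tri<; tri≈; tri>)
open import Relation.Unary using (Pred; Decidable)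
open import Relation.Nullary using (¬_; Dec; yes; no)
open import Relation.Nullary.Decidable using (does; recompute; dec-true; _×-dec_; _⊎-dec_; ¬?)

open ≡-Reasoning

module _ {A : Set} where

  unique-resp-↭ : {xs ys : List A} → xs ↭ ys → Unique xs → Unique ys
  unique-resp-↭ xs↭ys = Unique-resp-↭ (setoid A) (↭⇒↭ₛ xs↭ys)

  ∈⇒↭∷ : {x : A} {xs : List A} → x ∈ₗ xs → ∃ λ ys → xs ↭ x ∷ ys
  ∈⇒↭∷ {x} x∈ with ∈-∃++ x∈
  ... | ys , zs , refl = ys ++ zs , shift x ys zs

  length-rest≤ : {x : A} {xs ys : List A} {n : ℕ} → xs ↭ x ∷ ys → length xs ≤ suc n → length ys ≤ n
  length-rest≤ {n = n} xs↭ len = ℕ.≤-pred (subst (_≤ suc n) (↭-length xs↭) len)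

  module _ (f : A → ℕ) where

    ∃-argmax : {x : A} {xs : List A} → x ∈ₗ xs →
                ∃ λ y → y ∈ₗ xs × All (λ z → f z ≤ f y) xs
    ∃-argmax {x} {xs} x∈ =
      argmax f x xs , [ (λ y≡x → subst (_∈ₗ xs) (sym y≡x) x∈) , id ]′ (argmax-sel f x xs)
      , f[xs]≤f[argmax] x xs

    ∃-argmin-satisfying : {P : Pred A 0ℓ} → Decidable P → {x : A} {xs : List A} → x ∈ₗ xs → P x →
                         ∃ λ y → y ∈ₗ xs × P y × (∀ {z} → z ∈ₗ xs → P z → f y ≤ f z)
    ∃-argmin-satisfying {P} P? {x} {xs} x∈ px = y , proj₁ y∈×py , proj₂ y∈×py , minimal
      where
      candidates = filter P? xs
      y = argmin f x candidates
      y∈×py : y ∈ₗ xs × P y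
      y∈×py = [ (λ y≡x → subst (λ z → z ∈ₗ xs × P z) (sym y≡x) (x∈ , px)) , ∈-filter⁻ P? ]′
                (argmin-sel f x candidates)
      minimal : ∀ {z} → z ∈ₗ xs → P z → f y ≤ f z
      minimal z∈ pz = All.lookup (f[argmin]≤f[xs] x candidates) (∈-filter⁺ P? z∈ pz)

module _ {n : ℕ} {P : Pred (Fin n) 0ℓ} (P? : Decidable P) where

  subsetOf : Subset n
  subsetOf = tabulate (does ∘ P?)

  ∈-subsetOf⁺ : {x : Fin n} → P x → x ∈ subsetOf
  ∈-subsetOf⁺ {x} px =
    Vec.lookup⇒[]= x subsetOf (trans (Vec.lookup∘tabulate (does ∘ P?) x) (dec-true (P? x) px))

  ∈-subsetOf⁻ : {x : Fin n} → x ∈ subsetOf → P x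
  ∈-subsetOf⁻ {x} x∈ with P? x | trans (sym (Vec.[]=⇒lookup x∈)) (Vec.lookup∘tabulate (does ∘ P?) x)
  ... | yes px | _ = px
  ... | no _ | ()

module _ {A : Set} (R : A → A → Set) where

  PairsRelated : List A → Set
  PairsRelated (a ∷ b ∷ xs) = R a b × PairsRelated xs
  PairsRelated _ = ⊤

  Paired : List A → Set
  Paired [] = ⊤
  Paired (_ ∷ []) = ⊥
  Paired (a ∷ b ∷ xs) = R a b × Paired xs

  paired⇒pairsRelated : (xs : List A) → Paired xs → PairsRelated xs
  paired⇒pairsRelated [] _ = tt
  paired⇒pairsRelated (a ∷ b ∷ xs) (r , rs) = r , paired⇒pairsRelated xs rs

  pairsRelated⇒paired : ∀ n (xs : List A) → length xs ≡ 2 * n → PairsRelated xs → Paired xs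
  pairsRelated⇒paired zero [] _ _ = tt
  pairsRelated⇒paired (suc n) (a ∷ b ∷ xs) len (r , rs) =
    r , pairsRelated⇒paired n xs (ℕ.suc-injective (ℕ.suc-injective (trans len (ℕ.*-suc 2 n)))) rs
  pairsRelated⇒paired (suc n) (a ∷ []) len _ with trans len (ℕ.*-suc 2 n)
  ... | ()

  -- IsAlternating x unfolds to AtEvenPositions (λ u v → v <ᶠ u) x × AtOddPositions _<ᶠ_ x.
  AtEvenPositions : {k : ℕ} → Vec A k → Set
  AtEvenPositions {k} xs = ∀ j (p : 2 * j < k) (q : suc (2 * j) < k) →
                           R (lookup xs (fromℕ< p)) (lookup xs (fromℕ< q))

  AtOddPositions : {k : ℕ} → Vec A k → Set
  AtOddPositions {k} xs = ∀ j (p : suc (2 * j) < k) (q : suc (suc (2 * j)) < k) →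
                          R (lookup xs (fromℕ< p)) (lookup xs (fromℕ< q))

  private
    lookup-∷∷ : {k : ℕ} (a b : A) (xs : Vec A k) {i j : ℕ} → i ≡ suc (suc j) →
                .(p : i < suc (suc k)) .(q : j < k) → lookup (a ∷ b ∷ xs) (fromℕ< p) ≡ lookup xs (fromℕ< q)
    lookup-∷∷ a b xs refl p q = refl

    2*suc : ∀ j → 2 * suc j ≡ suc (suc (2 * j))
    2*suc j = ℕ.*-suc 2 j

  atEven⇒pairsRelated : {k : ℕ} (xs : Vec A k) → AtEvenPositions xs → PairsRelated (toList xs)
  atEven⇒pairsRelated [] _ = tt
  atEven⇒pairsRelated (a ∷ []) _ = tt
  atEven⇒pairsRelated {suc (suc k)} (a ∷ b ∷ xs) h =
    h 0 (s≤s z≤n) (s≤s (s≤s z≤n)) ,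
    atEven⇒pairsRelated xs λ j p q →
      subst₂ R (lookup-∷∷ a b xs (2*suc j) (p′ j p) p) (lookup-∷∷ a b xs (cong suc (2*suc j)) (q′ j q) q)
        (h (suc j) (p′ j p) (q′ j q))
    where
    p′ : ∀ j → 2 * j < k → 2 * suc j < suc (suc k)
    p′ j p = subst (_< suc (suc k)) (sym (2*suc j)) (s≤s (s≤s p))
    q′ : ∀ j → suc (2 * j) < k → suc (2 * suc j) < suc (suc k)
    q′ j q = subst (_< suc (suc k)) (sym (cong suc (2*suc j))) (s≤s (s≤s q))

  pairsRelated⇒atEven : {k : ℕ} (xs : Vec A k) → PairsRelated (toList xs) → AtEvenPositions xs
  pairsRelated⇒atEven (a ∷ b ∷ xs) (r , _) zero _ _ = r
  pairsRelated⇒atEven {suc (suc k)} (a ∷ b ∷ xs) (_ , rs) (suc j) p q =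
    subst₂ R (sym (lookup-∷∷ a b xs (2*suc j) p p')) (sym (lookup-∷∷ a b xs (cong suc (2*suc j)) q q'))
      (pairsRelated⇒atEven xs rs j p' q')
    where
    p' : 2 * j < k
    p' = ℕ.≤-pred (ℕ.≤-pred (subst (_< suc (suc k)) (2*suc j) p))
    q' : suc (2 * j) < k
    q' = ℕ.≤-pred (ℕ.≤-pred (subst (_< suc (suc k)) (cong suc (2*suc j)) q))
  pairsRelated⇒atEven (_ ∷ []) _ _ _ (s≤s ())

  atOdd⇒pairsRelated : {k : ℕ} (xs : Vec A k) → AtOddPositions xs → PairsRelated (drop 1 (toList xs))
  atOdd⇒pairsRelated [] _ = tt
  atOdd⇒pairsRelated (a ∷ xs) h = atEven⇒pairsRelated xs λ j p q → h j (s≤s p) (s≤s q)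

  pairsRelated⇒atOdd : {k : ℕ} (xs : Vec A k) → PairsRelated (drop 1 (toList xs)) → AtOddPositions xs
  pairsRelated⇒atOdd (a ∷ xs) rs j p q = pairsRelated⇒atEven xs rs j (ℕ.≤-pred p) (ℕ.≤-pred q)

module _ {A : Set} where

  uniqueVec⇒unique-toList : {k : ℕ} {xs : Vec A k} → VecUnique xs → Unique (toList xs)
  uniqueVec⇒unique-toList [] = []
  uniqueVec⇒unique-toList (x∉ ∷ uniq) = VecAll.toList⁺ x∉ ∷ uniqueVec⇒unique-toList uniq

  unique-toList⇒uniqueVec : {k : ℕ} {xs : Vec A k} → Unique (toList xs) → VecUnique xs
  unique-toList⇒uniqueVec {xs = []} [] = []
  unique-toList⇒uniqueVec {xs = _ ∷ _} (x∉ ∷ uniq) = VecAll.toList⁻ x∉ ∷ unique-toList⇒uniqueVec uniq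

  injective⇒unique-toList : {k : ℕ} (xs : Vec A k) → Injective _≡_ _≡_ (lookup xs) → Unique (toList xs)
  injective⇒unique-toList xs inj =
    uniqueVec⇒unique-toList (subst VecUnique (Vec.tabulate∘lookup xs) (VecUnique.tabulate⁺ inj))

  unique-toList⇒injective : {k : ℕ} (xs : Vec A k) → Unique (toList xs) → Injective _≡_ _≡_ (lookup xs)
  unique-toList⇒injective xs uniq = VecUnique.lookup-injective (unique-toList⇒uniqueVec uniq) _ _

  -- Uniqueness is a conjunction of negations, hence recoverable from an irrelevant proof.
  unique-recompute : {xs : List A} → .(Unique xs) → Unique xs
  unique-recompute {[]} _ = []
  unique-recompute {x ∷ xs} uniq =
    All.tabulate (λ y∈ x≡y → ⊥-elim-irr (All.lookup (AllPairs.head uniq) y∈ x≡y))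
    ∷ unique-recompute (AllPairs.tail uniq)

module _ {m : ℕ} where

  unique⇒length≤ : (E : List (Fin m)) → Unique E → length E ≤ m
  unique⇒length≤ E uniq =
    Fin.injective⇒≤ (unique-toList⇒injective (fromList E)
                                             (subst Unique (sym (Vec.toList∘fromList E)) uniq))

  covering⇒length≥ : (E : List (Fin m)) → (∀ k → k ∈ₗ E) → m ≤ length E
  covering⇒length≥ E covers = Fin.injective⇒≤ {f = index ∘ covers} λ {k} {k'} eq →
    trans (lookup-index (covers k)) (trans (cong (List.lookup E) eq) (sym (lookup-index (covers k'))))

  unique-of-length⇒covering : (E : List (Fin m)) → Unique E → length E ≡ m → ∀ k → k ∈ₗ E
  unique-of-length⇒covering E uniq len k with any? (k Fin.≟_) E
  ... | yes k∈ = k∈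
  ... | no k∉ = ⊥-elim (ℕ.<-irrefl refl (ℕ.≤-trans (s≤s (ℕ.≤-reflexive (sym len)))
                                                  (unique⇒length≤ (k ∷ E) (¬Any⇒All¬ E k∉ ∷ uniq))))

-- Two arcs

module _ {m : ℕ} where

  lo<hi : (a : Arc m) → lo a <ᶠ hi a
  lo<hi (Ref._,_ (l , h , _) [ wf ]) = recompute (toℕ l ℕ.<? toℕ h) (proj₁ wf)

  Interior : Arc m → Fin m → Set
  Interior a k = (lo a <ᶠ k) × (k <ᶠ hi a)

  Spans : Arc m → Fin m → Set
  Spans a k = (toℕ (lo a) ≤ toℕ k) × (toℕ k ≤ toℕ (hi a))

  passesLeft⇒interior : (a : Arc m) {k : Fin m} → PassesLeft a k → Interior a k
  passesLeft⇒interior (Ref._,_ (l , h , _) [ wf ]) {k} k∈ =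
    recompute ((toℕ l ℕ.<? toℕ k) ×-dec (toℕ k ℕ.<? toℕ h)) (proj₂ wf k k∈)

  interior⇒passesLeft⊎passesRight : (a : Arc m) {k : Fin m} → Interior a k →
                                    PassesLeft a k ⊎ PassesRight a k
  interior⇒passesLeft⊎passesRight a {k} (lo<k , k<hi) with k ∈? leftSet a
  ... | yes k∈ = inj₁ k∈
  ... | no k∉ = inj₂ (lo<k , k<hi , k∉)

  interior⇒spans : (a : Arc m) {k : Fin m} → Interior a k → Spans a k
  interior⇒spans a (lo<k , k<hi) = ℕ.<⇒≤ lo<k , ℕ.<⇒≤ k<hi

  endpoint⇒spans : (a : Arc m) {k : Fin m} → IsEndpoint a k → Spans a k
  endpoint⇒spans a (inj₁ refl) = ℕ.≤-refl , ℕ.<⇒≤ (lo<hi a)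
  endpoint⇒spans a (inj₂ refl) = ℕ.<⇒≤ (lo<hi a) , ℕ.≤-refl

  endpoint⇒¬interior : (a : Arc m) {k : Fin m} → IsEndpoint a k → ¬ Interior a k
  endpoint⇒¬interior a (inj₁ refl) (lo<lo , _) = ℕ.<-irrefl refl lo<lo
  endpoint⇒¬interior a (inj₂ refl) (_ , hi<hi) = ℕ.<-irrefl refl hi<hi

  strictlyLeftAt⇒spans : (a b : Arc m) {k : Fin m} → StrictlyLeftAt a b k → Spans a k × Spans b k
  strictlyLeftAt⇒spans a b (inj₁ (left , inj₁ end)) =
    interior⇒spans a (passesLeft⇒interior a left) , endpoint⇒spans b end
  strictlyLeftAt⇒spans a b (inj₁ (left , inj₂ (lo<k , k<hi , _))) =
    interior⇒spans a (passesLeft⇒interior a left) , interior⇒spans b (lo<k , k<hi)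
  strictlyLeftAt⇒spans a b (inj₂ (end , (lo<k , k<hi , _))) =
    endpoint⇒spans a end , interior⇒spans b (lo<k , k<hi)

  ¬strictlyLeftAt-self : (a : Arc m) {k : Fin m} → ¬ StrictlyLeftAt a a k
  ¬strictlyLeftAt-self a (inj₁ (left , inj₁ end)) =
    endpoint⇒¬interior a end (passesLeft⇒interior a left)
  ¬strictlyLeftAt-self a (inj₁ (left , inj₂ (_ , _ , notLeft))) = notLeft left
  ¬strictlyLeftAt-self a (inj₂ (end , (lo<k , k<hi , _))) = endpoint⇒¬interior a end (lo<k , k<hi)

  isEndpoint? : (a : Arc m) (k : Fin m) → Dec (IsEndpoint a k)
  isEndpoint? a k = (k Fin.≟ lo a) ⊎-dec (k Fin.≟ hi a)

  passesRight? : (a : Arc m) (k : Fin m) → Dec (PassesRight a k)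
  passesRight? a k =
    (toℕ (lo a) ℕ.<? toℕ k) ×-dec (toℕ k ℕ.<? toℕ (hi a)) ×-dec ¬? (k ∈? leftSet a)

  strictlyLeftAt? : (a b : Arc m) (k : Fin m) → Dec (StrictlyLeftAt a b k)
  strictlyLeftAt? a b k =
    (k ∈? leftSet a ×-dec (isEndpoint? b k ⊎-dec passesRight? b k))
    ⊎-dec (isEndpoint? a k ×-dec passesRight? b k)

  LeftOf : Arc m → Arc m → Set
  LeftOf a b = ∃ (StrictlyLeftAt a b)

  leftOf? : (a b : Arc m) → Dec (LeftOf a b)
  leftOf? a b = Fin.any? (strictlyLeftAt? a b)

  CommonEndpoint : Arc m → Arc m → Set
  CommonEndpoint a b = ∃ λ k → IsEndpoint a k × IsEndpoint b k

  Compatible : Arc m → Arc m → Set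
  Compatible a b = ¬ Cross a b × ¬ CommonEndpoint a b

  ¬common⇒endpoints-differ : (a b : Arc m) {k l : Fin m} → ¬ CommonEndpoint a b →
                             IsEndpoint a k → IsEndpoint b l → toℕ k ≢ toℕ l
  ¬common⇒endpoints-differ a b {k} noCommon ek el k≡l =
    noCommon (k , ek , subst (IsEndpoint b) (sym (Fin.toℕ-injective k≡l)) el)

  -- The point lo T lies inside both A and C; there A must pass left (else A, T cross)
  -- and C must pass right (else T, C cross).
  leftOf-trans-at-lo : (A T C : Arc m) → Compatible A T → Compatible T C →
                       lo A <ᶠ lo T → lo C <ᶠ lo T → LeftOf A T → LeftOf T C →
                       StrictlyLeftAt A C (lo T)
  leftOf-trans-at-lo A T C (noCrossAT , noCommonAT) (noCrossTC , noCommonTC)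
                     loA<loT loC<loT (k₁ , A<T) (k₂ , T<C)
    with strictlyLeftAt⇒spans A T A<T | strictlyLeftAt⇒spans T C T<C
  ... | (_ , k₁≤hiA) , (loT≤k₁ , _) | (loT≤k₂ , _) , (_ , k₂≤hiC)
    with interior⇒passesLeft⊎passesRight A (loA<loT , loT<hiA)
       | interior⇒passesLeft⊎passesRight C (loC<loT , loT<hiC)
    where
    loT<hiA = ℕ.≤∧≢⇒< (ℕ.≤-trans loT≤k₁ k₁≤hiA)
                (¬common⇒endpoints-differ A T noCommonAT (inj₂ refl) (inj₁ refl) ∘ sym)
    loT<hiC = ℕ.≤∧≢⇒< (ℕ.≤-trans loT≤k₂ k₂≤hiC)
                (¬common⇒endpoints-differ T C noCommonTC (inj₁ refl) (inj₂ refl))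
  ... | inj₂ rightA | _ = ⊥-elim (noCrossAT (k₁ , lo T , A<T , inj₂ (inj₁ refl , rightA)))
  ... | inj₁ _ | inj₁ leftC = ⊥-elim (noCrossTC (k₂ , lo T , T<C , inj₁ (leftC , inj₁ (inj₁ refl))))
  ... | inj₁ leftA | inj₂ rightC = inj₁ (leftA , inj₂ rightC)

  endpoint-inside⇒ordered : (X Y : Arc m) {k : Fin m} → Interior X k → IsEndpoint Y k →
                            LeftOf X Y ⊎ LeftOf Y X
  endpoint-inside⇒ordered X Y {k} inside end with interior⇒passesLeft⊎passesRight X inside
  ... | inj₁ left = inj₁ (k , inj₁ (left , inj₁ end))
  ... | inj₂ right = inj₂ (k , inj₂ (end , right))

  unordered⇒separated : (A C : Arc m) → ¬ CommonEndpoint A C → ¬ LeftOf A C → ¬ LeftOf C A →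
                        (hi A <ᶠ lo C) ⊎ (hi C <ᶠ lo A)
  unordered⇒separated A C noCommon ¬A<C ¬C<A
    with ℕ.<-cmp (toℕ (hi A)) (toℕ (lo C)) | ℕ.<-cmp (toℕ (hi C)) (toℕ (lo A))
  ... | tri< hiA<loC _ _ | _ = inj₁ hiA<loC
  ... | _ | tri< hiC<loA _ _ = inj₂ hiC<loA
  ... | tri≈ _ hiA≡loC _ | _ =
    ⊥-elim (¬common⇒endpoints-differ A C noCommon (inj₂ refl) (inj₁ refl) hiA≡loC)
  ... | _ | tri≈ _ hiC≡loA _ =
    ⊥-elim (¬common⇒endpoints-differ A C noCommon (inj₁ refl) (inj₂ refl) (sym hiC≡loA))
  ... | tri> _ _ loC<hiA | tri> _ _ loA<hiC with ℕ.<-cmp (toℕ (lo A)) (toℕ (lo C))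
  ...   | tri≈ _ loA≡loC _ =
    ⊥-elim (¬common⇒endpoints-differ A C noCommon (inj₁ refl) (inj₁ refl) loA≡loC)
  ...   | tri< loA<loC _ _ =
    ⊥-elim ([ ¬A<C , ¬C<A ]′ (endpoint-inside⇒ordered A C (loA<loC , loC<hiA) (inj₁ refl)))
  ...   | tri> _ _ loC<loA =
    ⊥-elim ([ ¬C<A , ¬A<C ]′ (endpoint-inside⇒ordered C A (loC<loA , loA<hiC) (inj₁ refl)))

  -- Arranging a noncrossing perfect matching

  Rightmost : Arc m → List (Arc m) → Set
  Rightmost A R = All (λ B → ¬ LeftOf A B) R

  rightmost? : (R : List (Arc m)) → Decidable (λ A → Rightmost A R)
  rightmost? R A = All.all? (λ B → ¬? (leftOf? A B)) R

  ¬leftOf-self : (a : Arc m) → ¬ LeftOf a a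
  ¬leftOf-self a (_ , a<a) = ¬strictlyLeftAt-self a a<a

  PairwiseCompatible : List (Arc m) → Set
  PairwiseCompatible R = ∀ {a b} → a ∈ₗ R → b ∈ₗ R → a ≢ b → Compatible a b

  PairwiseCompatible-resp-⊆ : {R S : List (Arc m)} → (∀ {a} → a ∈ₗ S → a ∈ₗ R) →
                              PairwiseCompatible R → PairwiseCompatible S
  PairwiseCompatible-resp-⊆ S⊆R compat a∈ b∈ = compat (S⊆R a∈) (S⊆R b∈)

  lo<lo-of-¬common : (a b : Arc m) → ¬ CommonEndpoint a b → toℕ (lo a) ≤ toℕ (lo b) → lo a <ᶠ lo b
  lo<lo-of-¬common a b noCommon loa≤lob =
    ℕ.≤∧≢⇒< loa≤lob (¬common⇒endpoints-differ a b noCommon (inj₁ refl) (inj₁ refl))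

  -- If M is left of T, then T left of B would put M left of B at the height lo T.
  rightmost-cons : (T : Arc m) {M : Arc m} {R : List (Arc m)} →
                   PairwiseCompatible (T ∷ R) → All (T ≢_) R →
                   All (λ C → toℕ (lo C) ≤ toℕ (lo T)) R → M ∈ₗ R → Rightmost M R →
                   ∃ λ A → A ∈ₗ T ∷ R × Rightmost A (T ∷ R)
  rightmost-cons T {M} {R} compat T∉R lo≤loT M∈ Mrm with leftOf? M T
  ... | no ¬M<T = M , there M∈ , ¬M<T ∷ Mrm
  ... | yes M<T = T , here refl , ¬leftOf-self T ∷ All.tabulate ¬T<B
    where
    compat-with-T : ∀ {B} → B ∈ₗ R → Compatible B T
    compat-with-T B∈ = compat (there B∈) (here refl) (λ B≡T → All.lookup T∉R B∈ (sym B≡T))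
    lo<loT : ∀ {B} → B ∈ₗ R → lo B <ᶠ lo T
    lo<loT {B} B∈ = lo<lo-of-¬common B T (proj₂ (compat-with-T B∈)) (All.lookup lo≤loT B∈)
    ¬T<B : ∀ {B} → B ∈ₗ R → ¬ LeftOf T B
    ¬T<B {B} B∈ T<B = All.lookup Mrm B∈
      (lo T , leftOf-trans-at-lo M T B (compat-with-T M∈)
                                 (compat (here refl) (there B∈) (All.lookup T∉R B∈))
                                 (lo<loT M∈) (lo<loT B∈) M<T T<B)

  -- T has the highest lower endpoint; recurse on the remaining arcs.
  rightmost-exists : ∀ n (R : List (Arc m)) → length R ≤ n → PairwiseCompatible R → Unique R →
                     {a : Arc m} → a ∈ₗ R → ∃ λ A → A ∈ₗ R × Rightmost A R
  rightmost-exists zero (_ ∷ _) () _ _ _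
  rightmost-exists (suc n) R len compat uniq a∈
    with T , T∈ , lo≤loT ← ∃-argmax (toℕ ∘ lo) a∈
    with R' , R↭ ← ∈⇒↭∷ T∈
    = Product.map₂ (Product.map (∈-resp-↭ (↭-sym R↭)) (All-resp-↭ (↭-sym R↭))) (rightmost-of-T∷R' R' R↭)
    where
    rightmost-of-T∷R' : (R' : List (Arc m)) → R ↭ T ∷ R' → ∃ λ A → A ∈ₗ T ∷ R' × Rightmost A (T ∷ R')
    rightmost-of-T∷R' [] _ = T , here refl , ¬leftOf-self T ∷ []
    rightmost-of-T∷R' R'@(_ ∷ _) R↭ = go (unique-resp-↭ R↭ uniq)
      where
      compat' : PairwiseCompatible (T ∷ R')
      compat' = PairwiseCompatible-resp-⊆ (∈-resp-↭ (↭-sym R↭)) compat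
      go : Unique (T ∷ R') → ∃ λ A → A ∈ₗ T ∷ R' × Rightmost A (T ∷ R')
      go (T∉R' ∷ uniq')
        with M , M∈ , Mrm ← rightmost-exists n R' (length-rest≤ R↭ len)
                              (PairwiseCompatible-resp-⊆ there compat') uniq' (here refl)
        = rightmost-cons T compat' T∉R' (All.tail (All-resp-↭ R↭ lo≤loT)) M∈ Mrm

  LoBelowNextHi : Arc m → Arc m → Set
  LoBelowNextHi a b = lo a <ᶠ hi b

  RightmostFirst : List (Arc m) → Set
  RightmostFirst = AllPairs (λ a b → ¬ LeftOf a b)

  Arranged : List (Arc m) → Set
  Arranged L = RightmostFirst L × Linked LoBelowNextHi L

  rightmost-head : {a : Arc m} {L : List (Arc m)} → Arranged (a ∷ L) → Rightmost a (a ∷ L)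
  rightmost-head {a} (a≮L ∷ _ , _) = ¬leftOf-self a ∷ a≮L

  rightmostFirst-noncrossing : {L : List (Arc m)} → RightmostFirst L →
                         ∀ {a b} → a ∈ₗ L → b ∈ₗ L → a ≢ b → ¬ Cross a b
  rightmostFirst-noncrossing _ (here refl) (here refl) a≢a _ = a≢a refl
  rightmostFirst-noncrossing (a≮ ∷ _) (here refl) (there b∈) _ (k₁ , _ , a<b , _) =
    All.lookup a≮ b∈ (k₁ , a<b)
  rightmostFirst-noncrossing (b≮ ∷ _) (there a∈) (here refl) _ (_ , k₂ , _ , b<a) =
    All.lookup b≮ a∈ (k₂ , b<a)
  rightmostFirst-noncrossing (_ ∷ ≮) (there a∈) (there b∈) = rightmostFirst-noncrossing ≮ a∈ b∈

  -- Either N' is rightmost in all of R, so lo N ≤ lo N' by the choice of N, or N' is left of N.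
  lo<hi-after-removal : {N N' : Arc m} {R R' : List (Arc m)} → R ↭ N ∷ R' → Compatible N N' →
                        (∀ {C} → C ∈ₗ R → Rightmost C R → toℕ (lo N) ≤ toℕ (lo C)) →
                        N' ∈ₗ R' → Rightmost N' R' → lo N <ᶠ hi N'
  lo<hi-after-removal {N} {N'} R↭ compat minimal N'∈ N'rm with leftOf? N' N
  ... | no ¬N'<N =
    ℕ.≤-<-trans (minimal (∈-resp-↭ (↭-sym R↭) (there N'∈)) (All-resp-↭ (↭-sym R↭) (¬N'<N ∷ N'rm)))
                (lo<hi N')
  ... | yes (_ , N'<N) with strictlyLeftAt⇒spans N' N N'<N
  ...   | (_ , k≤hiN') , (loN≤k , _) =
    ℕ.≤∧≢⇒< (ℕ.≤-trans loN≤k k≤hiN')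
            (¬common⇒endpoints-differ N N' (proj₂ compat) (inj₁ refl) (inj₂ refl))

  arranged-cons : {N : Arc m} {R R' L' : List (Arc m)} → R ↭ N ∷ R' →
                  PairwiseCompatible R → Unique (N ∷ R') → Rightmost N R →
                  (∀ {C} → C ∈ₗ R → Rightmost C R → toℕ (lo N) ≤ toℕ (lo C)) →
                  L' ↭ R' → Arranged L' → Arranged (N ∷ L')
  arranged-cons {N} {R} {R'} {L'} R↭ compat (N∉R' ∷ _) Nrm minimal L'↭ (L'≮ , L'linked) =
    All-resp-↭ (↭-sym L'↭) (All.tail (All-resp-↭ R↭ Nrm)) ∷ L'≮ , linked L' L'↭ L'≮ L'linked
    where
    linked : (L' : List (Arc m)) → L' ↭ R' → RightmostFirst L' →
             Linked LoBelowNextHi L' → Linked LoBelowNextHi (N ∷ L')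
    linked [] _ _ _ = [-]
    linked (N' ∷ _) L'↭ L'≮ L'linked =
      lo<hi-after-removal R↭ (compat (∈-resp-↭ (↭-sym R↭) (here refl)) (∈-resp-↭ (↭-sym R↭) (there N'∈))
                                     (All.lookup N∉R' N'∈))
        minimal N'∈ (All-resp-↭ L'↭ (rightmost-head (L'≮ , L'linked)))
      ∷ L'linked
      where
      N'∈ : N' ∈ₗ R'
      N'∈ = ∈-resp-↭ L'↭ (here refl)

  -- Repeatedly take, among the rightmost arcs, one with the lowest lower endpoint.
  arrange : ∀ n (R : List (Arc m)) → length R ≤ n → PairwiseCompatible R → Unique R →
            ∃ λ L → L ↭ R × Arranged L
  arrange _ [] _ _ _ = [] , ↭-refl , [] , []
  arrange zero (_ ∷ _) () _ _
  arrange (suc n) (a ∷ R₀) len compat uniq =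
    N ∷ L' , ↭-trans (↭-prep N (proj₁ (proj₂ rest))) (↭-sym R↭)
    , arranged-cons R↭ compat uniq' Nrm minimal (proj₁ (proj₂ rest)) (proj₂ (proj₂ rest))
    where
    R = a ∷ R₀
    A₀ = rightmost-exists (suc n) R len compat uniq (here refl)
    chosen = ∃-argmin-satisfying (toℕ ∘ lo) (rightmost? R) (proj₁ (proj₂ A₀)) (proj₂ (proj₂ A₀))
    N : Arc m
    N = proj₁ chosen
    Nrm : Rightmost N R
    Nrm = proj₁ (proj₂ (proj₂ chosen))
    minimal : ∀ {C} → C ∈ₗ R → Rightmost C R → toℕ (lo N) ≤ toℕ (lo C)
    minimal = proj₂ (proj₂ (proj₂ chosen))
    removal = ∈⇒↭∷ (proj₁ (proj₂ chosen))
    R' = proj₁ removal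
    R↭ : R ↭ N ∷ R'
    R↭ = proj₂ removal
    uniq' : Unique (N ∷ R')
    uniq' = unique-resp-↭ R↭ uniq
    rest = arrange n R' (length-rest≤ R↭ len)
                   (PairwiseCompatible-resp-⊆ (∈-resp-↭ (↭-sym R↭) ∘ there) compat) (AllPairs.tail uniq')
    L' = proj₁ rest

  Arranged-tail : {a : Arc m} {L : List (Arc m)} → Arranged (a ∷ L) → Arranged L
  Arranged-tail (≮ , linked) = AllPairs.tail ≮ , Linked.tail linked

  -- An arc C after a that is right of every arc lies entirely above a: by
  -- unordered⇒separated it lies above or below a, and below is excluded by the chain of
  -- inequalities lo a < hi b < lo C < hi C.
  rightmost-lies-above : {a C : Arc m} {L : List (Arc m)} → Arranged (a ∷ L) →
                         PairwiseCompatible (a ∷ L) → Unique (a ∷ L) →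
                         C ∈ₗ L → Rightmost C (a ∷ L) → hi a <ᶠ lo C
  rightmost-lies-above {a} {C} {b ∷ L} arranged@(a≮ ∷ _ , loa<hib ∷ _) compat (a∉ ∷ uniq) C∈ Crm
    with unordered⇒separated a C (proj₂ (compat (here refl) (there C∈) (All.lookup a∉ C∈)))
                                 (All.lookup a≮ C∈) (All.head Crm)
  ... | inj₁ hia<loC = hia<loC
  ... | inj₂ hiC<loa with C∈
  ...   | here refl = ⊥-elim (ℕ.<-asym loa<hib hiC<loa)
  ...   | there C∈L = ⊥-elim (ℕ.<-asym (ℕ.<-trans loa<hib (ℕ.<-trans hib<loC (lo<hi C))) hiC<loa)
    where
    hib<loC : hi b <ᶠ lo C
    hib<loC = rightmost-lies-above (Arranged-tail arranged) (PairwiseCompatible-resp-⊆ there compat)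
                                   uniq C∈L (All.tail Crm)

  -- Distinct heads would both be rightmost overall, so each would lie above the other.
  arranged-unique : {L₁ L₂ : List (Arc m)} → L₁ ↭ L₂ → Arranged L₁ → Arranged L₂ →
                    PairwiseCompatible L₁ → Unique L₁ → L₁ ≡ L₂
  arranged-unique {[]} {[]} _ _ _ _ _ = refl
  arranged-unique {[]} {_ ∷ _} p _ _ _ _ = ⊥-elim (¬x∷xs↭[] (↭-sym p))
  arranged-unique {_ ∷ _} {[]} p _ _ _ _ = ⊥-elim (¬x∷xs↭[] p)
  arranged-unique {a ∷ L₁} {b ∷ L₂} p ar₁ ar₂ compat uniq@(_ ∷ uniq₁)
    with ∈-resp-↭ p (here refl) | ∈-resp-↭ (↭-sym p) (here refl)
  ... | here refl | _ = cong (a ∷_) tails-equal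
    where
    tails-equal : L₁ ≡ L₂
    tails-equal = arranged-unique (drop-∷ p) (Arranged-tail ar₁) (Arranged-tail ar₂)
                                  (PairwiseCompatible-resp-⊆ there compat) uniq₁
  ... | there a∈L₂ | here refl with a∉L₂ ∷ _ ← unique-resp-↭ p uniq = ⊥-elim (All.lookup a∉L₂ a∈L₂ refl)
  ... | there a∈L₂ | there b∈L₁ =
    ⊥-elim (ℕ.<-asym (ℕ.<-trans (lo<hi a) hia<lob) (ℕ.<-trans (lo<hi b) hib<loa))
    where
    hia<lob : hi a <ᶠ lo b
    hia<lob = rightmost-lies-above ar₁ compat uniq b∈L₁ (All-resp-↭ (↭-sym p) (rightmost-head ar₂))
    hib<loa : hi b <ᶠ lo a
    hib<loa = rightmost-lies-above ar₂ (PairwiseCompatible-resp-⊆ (∈-resp-↭ (↭-sym p)) compat)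
                                   (unique-resp-↭ p uniq) a∈L₂ (All-resp-↭ p (rightmost-head ar₁))

  -- From a word to an arc diagram

  endpoints : List (Arc m) → List (Fin m)
  endpoints [] = []
  endpoints (a ∷ L) = hi a ∷ lo a ∷ endpoints L

  endpoint-∈-endpoints : {L : List (Arc m)} {a : Arc m} {k : Fin m} →
                         a ∈ₗ L → IsEndpoint a k → k ∈ₗ endpoints L
  endpoint-∈-endpoints (here refl) (inj₁ refl) = there (here refl)
  endpoint-∈-endpoints (here refl) (inj₂ refl) = here refl
  endpoint-∈-endpoints (there a∈) end = there (there (endpoint-∈-endpoints a∈ end))

  ∈-endpoints⁻ : (L : List (Arc m)) {k : Fin m} → k ∈ₗ endpoints L → ∃ λ a → a ∈ₗ L × IsEndpoint a k
  ∈-endpoints⁻ (a ∷ L) (here refl) = a , here refl , inj₂ refl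
  ∈-endpoints⁻ (a ∷ L) (there (here refl)) = a , here refl , inj₁ refl
  ∈-endpoints⁻ (a ∷ L) (there (there k∈)) with ∈-endpoints⁻ L k∈
  ... | b , b∈ , end = b , there b∈ , end

  Descending : List (Fin m) → Set
  Descending = Paired (λ h l → l <ᶠ h)

  BetweenEarlier : Fin m → Fin m → List (Fin m) → Fin m → Set
  BetweenEarlier l h earlier y = (l <ᶠ y) × (y <ᶠ h) × (y ∈ₗ earlier)

  betweenEarlier? : (l h : Fin m) (earlier : List (Fin m)) → Decidable (BetweenEarlier l h earlier)
  betweenEarlier? l h earlier y =
    (toℕ l ℕ.<? toℕ y) ×-dec (toℕ y ℕ.<? toℕ h) ×-dec any? (y Fin.≟_) earlier

  arcFrom : (l h : Fin m) → .(l <ᶠ h) → List (Fin m) → Arc m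
  arcFrom l h l<h earlier =
    Ref._,_ (l , h , subsetOf (betweenEarlier? l h earlier)) [ l<h , between⇒interior ]
    where
    between⇒interior : ∀ k → k ∈ subsetOf (betweenEarlier? l h earlier) → (l <ᶠ k) × (k <ᶠ h)
    between⇒interior k k∈ with l<k , k<h , _ ← ∈-subsetOf⁻ (betweenEarlier? l h earlier) k∈ = l<k , k<h

  passesLeft-arcFrom : (l h : Fin m) .(l<h : l <ᶠ h) (earlier : List (Fin m)) {y : Fin m} →
                       PassesLeft (arcFrom l h l<h earlier) y ⇔ BetweenEarlier l h earlier y
  passesLeft-arcFrom l h _ earlier =
    mk⇔ (∈-subsetOf⁻ (betweenEarlier? l h earlier)) (∈-subsetOf⁺ (betweenEarlier? l h earlier))

  build : (earlier E : List (Fin m)) → .(Descending E) → List (Arc m)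
  build earlier [] _ = []
  build earlier (h ∷ l ∷ E) d = arcFrom l h (proj₁ d) earlier ∷ build (h ∷ l ∷ earlier) E (proj₂ d)

  endpoints-build : (earlier E : List (Fin m)) (d : Descending E) → endpoints (build earlier E d) ≡ E
  endpoints-build earlier [] _ = refl
  endpoints-build earlier (h ∷ l ∷ E) (_ , d) =
    cong (λ E' → h ∷ l ∷ E') (endpoints-build (h ∷ l ∷ earlier) E d)

  build-passesLeft-earlier : (earlier E : List (Fin m)) (d : Descending E) {b : Arc m} {y : Fin m} →
                             b ∈ₗ build earlier E d → y ∈ₗ earlier → Interior b y → PassesLeft b y
  build-passesLeft-earlier earlier (h ∷ l ∷ E) d (here refl) y∈ (l<y , y<h) =
    Equivalence.from (passesLeft-arcFrom l h (proj₁ d) earlier) (l<y , y<h , y∈)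
  build-passesLeft-earlier earlier (h ∷ l ∷ E) (_ , d) (there b∈) y∈ =
    build-passesLeft-earlier (h ∷ l ∷ earlier) E d b∈ (there (there y∈))

  -- A later arc passes left of every earlier endpoint inside it, so no earlier arc is left of it.
  build-rightmost-first : (earlier E : List (Fin m)) (d : Descending E) → Unique E →
                          Disjoint earlier E → RightmostFirst (build earlier E d)
  build-rightmost-first earlier [] _ _ _ = []
  build-rightmost-first earlier (h ∷ l ∷ E) (l<h , d) ((_ ∷ h∉E) ∷ l∉E ∷ uniq) disj =
    All.tabulate ¬a<b ∷ build-rightmost-first (h ∷ l ∷ earlier) E d uniq disj'
    where
    earlier' = h ∷ l ∷ earlier
    disj' : Disjoint earlier' E
    disj' (here refl , h∈E) = All.lookup h∉E h∈E refl
    disj' (there (here refl) , l∈E) = All.lookup l∉E l∈E refl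
    disj' (there (there v∈) , v∈E) = disj (v∈ , there (there v∈E))
    left⇒earlier : {k : Fin m} → PassesLeft (arcFrom l h l<h earlier) k → k ∈ₗ earlier
    left⇒earlier left = proj₂ (proj₂ (Equivalence.to (passesLeft-arcFrom l h l<h earlier) left))
    endpoint∈earlier' : {k : Fin m} → (k ≡ l) ⊎ (k ≡ h) → k ∈ₗ earlier'
    endpoint∈earlier' (inj₁ refl) = there (here refl)
    endpoint∈earlier' (inj₂ refl) = here refl
    ¬a<b : {b : Arc m} → b ∈ₗ build earlier' E d → ¬ LeftOf (arcFrom l h l<h earlier) b
    ¬a<b b∈ (k , inj₁ (aLeft , inj₁ bEnd)) =
      disj (left⇒earlier aLeft ,
            there (there (subst (k ∈ₗ_) (endpoints-build earlier' E d) (endpoint-∈-endpoints b∈ bEnd))))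
    ¬a<b b∈ (k , inj₁ (aLeft , inj₂ (lo<k , k<hi , k∉))) =
      k∉ (build-passesLeft-earlier earlier' E d b∈ (there (there (left⇒earlier aLeft))) (lo<k , k<hi))
    ¬a<b b∈ (k , inj₂ (aEnd , (lo<k , k<hi , k∉))) =
      k∉ (build-passesLeft-earlier earlier' E d b∈ (endpoint∈earlier' aEnd) (lo<k , k<hi))

  EndpointDisjoint : List (Arc m) → Set
  EndpointDisjoint L = ∀ {a b} → a ∈ₗ L → b ∈ₗ L → a ≢ b → ¬ CommonEndpoint a b

  unique-endpoints⇒ : (L : List (Arc m)) → Unique (endpoints L) → Unique L × EndpointDisjoint L
  unique-endpoints⇒ [] _ = [] , λ ()
  unique-endpoints⇒ (a ∷ L) ((_ ∷ hi∉) ∷ lo∉ ∷ uniq)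
    with uniqL , disjL ← unique-endpoints⇒ L uniq =
    All.tabulate (λ b∈ a≡b → All.lookup hi∉ (endpoint-∈-endpoints b∈ (inj₂ (cong hi a≡b))) refl) ∷ uniqL ,
    disj
    where
    a-endpoint∉ : {k : Fin m} → IsEndpoint a k → k ∈ₗ endpoints L → ⊥
    a-endpoint∉ (inj₁ refl) k∈ = All.lookup lo∉ k∈ refl
    a-endpoint∉ (inj₂ refl) k∈ = All.lookup hi∉ k∈ refl
    disj : EndpointDisjoint (a ∷ L)
    disj (here refl) (here refl) a≢a _ = a≢a refl
    disj (here refl) (there b∈) _ (k , aEnd , bEnd) = a-endpoint∉ aEnd (endpoint-∈-endpoints b∈ bEnd)
    disj (there b∈) (here refl) _ (k , bEnd , aEnd) = a-endpoint∉ aEnd (endpoint-∈-endpoints b∈ bEnd)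
    disj (there b∈) (there c∈) = disjL b∈ c∈

  unique-endpoints⇐ : (L : List (Arc m)) → Unique L → EndpointDisjoint L → Unique (endpoints L)
  unique-endpoints⇐ [] _ _ = []
  unique-endpoints⇐ (a ∷ L) (a∉ ∷ uniq) disj =
    ((λ hi≡lo → ℕ.<-irrefl (cong toℕ (sym hi≡lo)) (lo<hi a)) ∷ All.tabulate (shared (inj₂ refl)))
    ∷ All.tabulate (shared (inj₁ refl))
    ∷ unique-endpoints⇐ L uniq (λ b∈ c∈ → disj (there b∈) (there c∈))
    where
    shared : {k k' : Fin m} → IsEndpoint a k → k' ∈ₗ endpoints L → k ≢ k'
    shared aEnd k'∈ refl with b , b∈ , bEnd ← ∈-endpoints⁻ L k'∈ =
      disj (here refl) (there b∈) (All.lookup a∉ b∈) (_ , aEnd , bEnd)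

  linked⇒pairsRelated : (L : List (Arc m)) → Linked LoBelowNextHi L →
                        PairsRelated _<ᶠ_ (drop 1 (endpoints L))
  linked⇒pairsRelated [] _ = tt
  linked⇒pairsRelated (_ ∷ []) _ = tt
  linked⇒pairsRelated (a ∷ b ∷ L) (r ∷ rs) = r , linked⇒pairsRelated (b ∷ L) rs

  pairsRelated⇒linked : (L : List (Arc m)) → PairsRelated _<ᶠ_ (drop 1 (endpoints L)) →
                        Linked LoBelowNextHi L
  pairsRelated⇒linked [] _ = []
  pairsRelated⇒linked (_ ∷ []) _ = [-]
  pairsRelated⇒linked (a ∷ b ∷ L) (r , rs) = r ∷ pairsRelated⇒linked (b ∷ L) rs

  endpoints-descending : (L : List (Arc m)) → Descending (endpoints L)
  endpoints-descending [] = tt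
  endpoints-descending (a ∷ L) = lo<hi a , endpoints-descending L

  build-cong : (earlier : List (Fin m)) {E E' : List (Fin m)} → E ≡ E' →
               .(d : Descending E) .(d' : Descending E') → build earlier E d ≡ build earlier E' d'
  build-cong earlier refl d d' = refl

  -- build recovers an arrangement: the left set of each arc consists exactly of the
  -- earlier endpoints inside it, since a later endpoint inside a would make a left of a later arc.
  build-endpoints : (earlier : List (Fin m)) (L : List (Arc m)) →
                    RightmostFirst L → (∀ y → y ∈ₗ earlier ⊎ y ∈ₗ endpoints L) →
                    (∀ {a y} → a ∈ₗ L → y ∈ₗ earlier → Interior a y → PassesLeft a y) →
                    build earlier (endpoints L) (endpoints-descending L) ≡ L
  build-endpoints earlier [] _ _ _ = refl
  build-endpoints earlier (a ∷ L) (a≮L ∷ ≮L) covers passesLeft =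
    cong₂ _∷_ (Ref.value-injective (cong (λ S → lo a , hi a , S) leftSets-equal))
              (build-endpoints (hi a ∷ lo a ∷ earlier) L ≮L covers' passesLeft')
    where
    leftSet⊆earlier : ∀ {y} → y ∈ leftSet a → y ∈ₗ earlier
    leftSet⊆earlier {y} y∈ with covers y
    ... | inj₁ y∈earlier = y∈earlier
    ... | inj₂ (here refl) = ⊥-elim (endpoint⇒¬interior a (inj₂ refl) (passesLeft⇒interior a y∈))
    ... | inj₂ (there (here refl)) = ⊥-elim (endpoint⇒¬interior a (inj₁ refl) (passesLeft⇒interior a y∈))
    ... | inj₂ (there (there y∈endsL)) with b , b∈ , bEnd ← ∈-endpoints⁻ L y∈endsL =
      ⊥-elim (All.lookup a≮L b∈ (y , inj₁ (y∈ , inj₁ bEnd)))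
    leftSets-equal : leftSet (arcFrom (lo a) (hi a) (lo<hi a) earlier) ≡ leftSet a
    leftSets-equal = ⊆-antisym
      (λ y∈ → let (lo<y , y<hi , y∈earlier) = Equivalence.to left⇔ y∈ in
              passesLeft (here refl) y∈earlier (lo<y , y<hi))
      (λ y∈ → let (lo<y , y<hi) = passesLeft⇒interior a y∈ in
              Equivalence.from left⇔ (lo<y , y<hi , leftSet⊆earlier y∈))
      where left⇔ = passesLeft-arcFrom (lo a) (hi a) (lo<hi a) earlier
    covers' : ∀ y → y ∈ₗ hi a ∷ lo a ∷ earlier ⊎ y ∈ₗ endpoints L
    covers' y with covers y
    ... | inj₁ y∈ = inj₁ (there (there y∈))
    ... | inj₂ (here y≡hi) = inj₁ (here y≡hi)
    ... | inj₂ (there (here y≡lo)) = inj₁ (there (here y≡lo))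
    ... | inj₂ (there (there y∈)) = inj₂ y∈
    passesLeft' : ∀ {b y} → b ∈ₗ L → y ∈ₗ hi a ∷ lo a ∷ earlier → Interior b y → PassesLeft b y
    passesLeft' b∈ (there (there y∈)) inside = passesLeft (there b∈) y∈ inside
    passesLeft' {b} {y} b∈ (here refl) inside with interior⇒passesLeft⊎passesRight b inside
    ... | inj₁ left = left
    ... | inj₂ right = ⊥-elim (All.lookup a≮L b∈ (y , inj₂ (inj₂ refl , right)))
    passesLeft' {b} {y} b∈ (there (here refl)) inside with interior⇒passesLeft⊎passesRight b inside
    ... | inj₁ left = left
    ... | inj₂ right = ⊥-elim (All.lookup a≮L b∈ (y , inj₂ (inj₁ refl , right)))

-- The bijection

module _ (n : ℕ) where

  M : ℕ
  M = 2 * n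

  alternating⇒descending : (x : Vec (Fin M) M) → IsAlternating x → Descending (toList x)
  alternating⇒descending x (down , _) =
    pairsRelated⇒paired _ n (toList x) (Vec.length-toList x) (atEven⇒pairsRelated _ x down)

  matchingOf : (x : Vec (Fin M) M) → .(IsAlternating x) → List (Arc M)
  matchingOf x alt = build [] (toList x) (alternating⇒descending x alt)

  module _ (x : Vec (Fin M) M) (perm : IsPermutation x) (alt : IsAlternating x) where

    endpoints-matchingOf : endpoints (matchingOf x alt) ≡ toList x
    endpoints-matchingOf = endpoints-build [] (toList x) (alternating⇒descending x alt)

    unique-endpoints-matchingOf : Unique (endpoints (matchingOf x alt))
    unique-endpoints-matchingOf = subst Unique (sym endpoints-matchingOf) (injective⇒unique-toList x perm)

    matchingOf-arranged : Arranged (matchingOf x alt)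
    matchingOf-arranged =
      build-rightmost-first [] (toList x) (alternating⇒descending x alt)
                            (injective⇒unique-toList x perm) (λ ()) ,
      pairsRelated⇒linked _ (subst (PairsRelated _<ᶠ_ ∘ drop 1) (sym endpoints-matchingOf)
                                   (atOdd⇒pairsRelated _ x (proj₂ alt)))

    matchingOf-unique : Unique (matchingOf x alt)
    matchingOf-unique = proj₁ (unique-endpoints⇒ _ unique-endpoints-matchingOf)

    matchingOf-endpointDisjoint : EndpointDisjoint (matchingOf x alt)
    matchingOf-endpointDisjoint = proj₂ (unique-endpoints⇒ _ unique-endpoints-matchingOf)

    matchingOf-compatible : PairwiseCompatible (matchingOf x alt)
    matchingOf-compatible a∈ b∈ a≢b =
      rightmostFirst-noncrossing (proj₁ matchingOf-arranged) a∈ b∈ a≢b ,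
      matchingOf-endpointDisjoint a∈ b∈ a≢b

    matchingOf-isNoncrossingPerfectMatching :
      IsNoncrossingArcDiagram (matchingOf x alt) × IsPerfectMatching (matchingOf x alt)
    matchingOf-isNoncrossingPerfectMatching =
      (matchingOf-unique ,
       λ a b a∈ b∈ a≢b → proj₁ (matchingOf-compatible a∈ b∈ a≢b)
                       , (λ lo≡ → matchingOf-endpointDisjoint a∈ b∈ a≢b (lo a , inj₁ refl , inj₁ lo≡))
                       , (λ hi≡ → matchingOf-endpointDisjoint a∈ b∈ a≢b (hi a , inj₂ refl , inj₂ hi≡))) ,
      (λ a b → matchingOf-endpointDisjoint) ,
      λ k → ∈-endpoints⁻ _ (subst (k ∈ₗ_) (sym endpoints-matchingOf)
              (unique-of-length⇒covering (toList x) (injective⇒unique-toList x perm)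
                                         (Vec.length-toList x) k))

  toMatching : AltPerm M → NoncrossingPerfectMatching M
  toMatching (Ref._,_ x [ perm×alt ]) =
    Ref._,_ (matchingOf x (proj₂ perm×alt))
            [ matchingOf-isNoncrossingPerfectMatching x (proj₁ perm×alt) (proj₂ perm×alt) ]

  matchingOf-injective : (x y : Vec (Fin M) M) (px : IsPermutation x) (ax : IsAlternating x)
                         (py : IsPermutation y) (ay : IsAlternating y) →
                         matchingOf x ax ↭ matchingOf y ay → x ≡ y
  matchingOf-injective x y px ax py ay x↭y =
    trans (sym (cast-is-id refl x)) (Vec.toList-injective refl x y (begin
      toList x                     ≡⟨ sym (endpoints-matchingOf x px ax) ⟩
      endpoints (matchingOf x ax)  ≡⟨ cong endpoints same-matching ⟩
      endpoints (matchingOf y ay)  ≡⟨ endpoints-matchingOf y py ay ⟩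
      toList y                     ∎))
    where
    same-matching : matchingOf x ax ≡ matchingOf y ay
    same-matching = arranged-unique x↭y (matchingOf-arranged x px ax) (matchingOf-arranged y py ay)
                                    (matchingOf-compatible x px ax) (matchingOf-unique x px ax)

  module _ (L : List (Arc M)) (arranged : Arranged L) (uniqE : Unique (endpoints L))
           (lengthE : length (endpoints L) ≡ M) where

    wordOf : Vec (Fin M) M
    wordOf = cast lengthE (fromList (endpoints L))

    toList-wordOf : toList wordOf ≡ endpoints L
    toList-wordOf = trans (Vec.toList-cast lengthE (fromList (endpoints L)))
                          (Vec.toList∘fromList (endpoints L))

    wordOf-isPermutation : IsPermutation wordOf
    wordOf-isPermutation = unique-toList⇒injective wordOf (subst Unique (sym toList-wordOf) uniqE)

    wordOf-isAlternating : IsAlternating wordOf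
    wordOf-isAlternating =
      pairsRelated⇒atEven _ wordOf (subst (PairsRelated _) (sym toList-wordOf)
                                          (paired⇒pairsRelated _ _ (endpoints-descending L))) ,
      pairsRelated⇒atOdd _ wordOf (subst (PairsRelated _<ᶠ_ ∘ drop 1) (sym toList-wordOf)
                                         (linked⇒pairsRelated L (proj₂ arranged)))

    matchingOf-wordOf : matchingOf wordOf wordOf-isAlternating ≡ L
    matchingOf-wordOf = trans (build-cong [] toList-wordOf _ _)
      (build-endpoints [] L (proj₁ arranged)
        (λ k → inj₂ (unique-of-length⇒covering (endpoints L) uniqE lengthE k)) (λ _ ()))

  toMatching-surjective : (D : NoncrossingPerfectMatching M) →
                          ∃ λ (x : AltPerm M) → value (toMatching x) ↭ value D
  toMatching-surjective (Ref._,_ D [ npm ]) =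
    Ref._,_ (wordOf L arranged uniqE lengthE)
            [ wordOf-isPermutation L arranged uniqE lengthE ,
              wordOf-isAlternating L arranged uniqE lengthE ]
    , subst (_↭ D) (sym (matchingOf-wordOf L arranged uniqE lengthE)) L↭D
    where
    uniqD : Unique D
    uniqD = unique-recompute (proj₁ (proj₁ npm))
    compatD : PairwiseCompatible D
    compatD a∈ b∈ a≢b = (λ cross → ⊥-elim-irr (proj₁ (proj₂ (proj₁ npm) _ _ a∈ b∈ a≢b) cross))
                      , (λ common → ⊥-elim-irr (proj₁ (proj₂ npm) _ _ a∈ b∈ a≢b common))
    arrangement = arrange (length D) D ℕ.≤-refl compatD uniqD
    L = proj₁ arrangement
    L↭D = proj₁ (proj₂ arrangement)
    arranged = proj₂ (proj₂ arrangement)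
    uniqE : Unique (endpoints L)
    uniqE = unique-endpoints⇐ L (unique-resp-↭ (↭-sym L↭D) uniqD)
              (λ a∈ b∈ a≢b → proj₂ (compatD (∈-resp-↭ L↭D a∈) (∈-resp-↭ L↭D b∈) a≢b))
    covered : (∀ k → ∃ λ a → a ∈ₗ D × IsEndpoint a k) → ∀ k → k ∈ₗ endpoints L
    covered covers k with a , a∈ , end ← covers k = endpoint-∈-endpoints (∈-resp-↭ (↭-sym L↭D) a∈) end
    lengthE : length (endpoints L) ≡ M
    lengthE = recompute (length (endpoints L) ℕ.≟ M)
      (ℕ.≤-antisym (unique⇒length≤ (endpoints L) uniqE)
                   (covering⇒length≥ (endpoints L) (covered (proj₂ (proj₂ npm)))))

  bijection : Bijection (setoid (AltPerm M)) (NoncrossingPerfectMatchingSetoid M)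
  bijection = record
    { to = toMatching
    ; cong = λ { refl → ↭-refl }
    ; bijective = injective , λ D → Product.map id (λ x↭D → λ { refl → x↭D }) (toMatching-surjective D)
    }
    where
    injective : ∀ {x y} → value (toMatching x) ↭ value (toMatching y) → x ≡ y
    injective {Ref._,_ x [ px ]} {Ref._,_ y [ py ]} x↭y = Ref.value-injective
      (recompute (Vec.≡-dec Fin._≟_ x y)
               (matchingOf-injective x y (proj₁ px) (proj₂ px) (proj₁ py) (proj₂ py) x↭y))

theorem3p9 : (n : ℕ) → 1 ≤ n →
    Bijection (setoid (AltPerm (2 * n))) (NoncrossingPerfectMatchingSetoid (2 * n))
-- For n = 0 both sides are singletons.
theorem3p9 n _ = bijection n
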